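{- Let $k\geq 2$ be an integer. Every linear hypergraph of rank $r$ with minimum degree at least $k^2-k$ has a $\frac{1}{k}$-majority $(kr+1)$-edge-colouring.
   Context: A hypergraph $H=(V,E)$ consists of a finite vertex set $V$ and a collection $E$ of non-empty subsets of $V$ (hyperedges). The degree $d(v)$ of $v\in V$ is the number of hyperedges containing $v$; the minimum degree is $\min_{v\in V} d(v)$; the rank (maximum edge size) is $r=\max_{e\in E}|e|$. $H$ is linear if $|e_1\cap e_2|\leq 1$ for all distinct $e_1,e_2\in E$. For integers $k\geq 2$ and $m\geq 1$, a $\frac{1}{k}$-majority $m$-edge-colouring of $H$ is a map $c:E\to\{1,\dots,m\}$ such that for every vertex $v$ and every colour $i$, the number of hyperedges $e\ni v$ with $c(e)=i$ is at most $\lfloor d(v)/k\rfloor$. -}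

module Defs where

open import Data.Nat using (ℕ; _≤_; _*_; _∸_; _+_; NonZero)
open import Data.Nat.DivMod using (_/_)
open import Data.Fin using (Fin; _≟_)
open import Data.Fin.Subset using (Subset; _∈_; _∩_; ∣_∣; Nonempty)
open import Data.Fin.Subset.Properties using (_∈?_)
open import Data.List using (List; filter; length; allFin)
open import Data.Product using (_×_; ∃)
open import Relation.Binary.PropositionalEquality using (_≡_; _≢_)
open import Relation.Nullary using (¬_)
open import Relation.Nullary.Decidable using (_×-dec_)
open import Function.Definitions using (Injective)

-- A hypergraph on vertex set Fin n with m hyperedges, indexed by Fin m.
-- Since E is a *set* of subsets, the indexing is injective.
record Hypergraph (n m : ℕ) : Set where
  field
    edge     : Fin m → Subset n
    nonempty : ∀ i → Nonempty (edge i)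
    distinct : Injective _≡_ _≡_ edge
open Hypergraph public

module _ {n m : ℕ} (H : Hypergraph n m) where

  degree : Fin n → ℕ
  degree v = length (filter (λ j → v ∈? edge H j) (allFin m))

  MinDegreeAtLeast : ℕ → Set
  MinDegreeAtLeast δ = ∀ v → δ ≤ degree v

  HasRank : ℕ → Set
  HasRank r = (∀ i → ∣ edge H i ∣ ≤ r) × ∃ (λ i → ∣ edge H i ∣ ≡ r)

  Linear : Set
  Linear = ∀ i j → i ≢ j → ∣ edge H i ∩ edge H j ∣ ≤ 1

  colourDegree : ∀ {q} → (Fin m → Fin q) → Fin n → Fin q → ℕ
  colourDegree c v a =
    length (filter (λ j → (v ∈? edge H j) ×-dec (c j ≟ a)) (allFin m))

  IsMajorityColouring : (k q : ℕ) → .{{NonZero k}} → (Fin m → Fin q) → Set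
  IsMajorityColouring k q c = ∀ v a → colourDegree c v a ≤ degree v / k

-- Colour the edges greedily, one at a time, and call a colour saturated at v
-- once it already occupies ⌊d(v)/k⌋ edges at v.  When an edge through v is
-- about to be coloured, at most d(v) − 1 edges at v carry a colour, so B
-- saturated colours give B·⌊d(v)/k⌋ < d(v); together with d(v) ≥ k² − k this
-- forces B ≤ k.  Hence the at most r vertices of the edge rule out at most kr
-- colours, and one of the kr + 1 colours is still free.
module Submission where

open import Defs
open import Data.Bool using (true; false; if_then_else_)
open import Data.Fin using (Fin; zero; suc; _≟_)
open import Data.Fin.Subset using (Subset; _∈_; ∣_∣; inside; outside)
open import Data.Fin.Subset.Properties using (_∈?_)
open import Data.List using (filter; length; allFin; tabulate)
open import Data.Nat using (ℕ; zero; suc; _≤_; _<_; _≤?_; _*_; _∸_; _+_; NonZero; z≤n; s≤s; s≤s⁻¹)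
open import Data.Nat.DivMod using (_/_; _%_; m≡m%n+[m/n]*n; m%n<n)
open import Data.Nat.Properties hiding (_≟_)
open import Algebra.Properties.Semiring.Sum +-*-semiring
  using (sum; sum-syntax; sum-cong-≗; sum-replicate-zero; ∑-comm; *-distribˡ-sum)
open import Data.Product using (Σ; ∃; _,_)
open import Data.Vec using ([]; _∷_)
open import Data.Vec.Functional using (tail) renaming (_∷_ to _◂_)
open import Function using (_∘_)
open import Level using (Level)
open import Relation.Binary.PropositionalEquality
open import Relation.Nullary using (Dec; yes; no; does; ¬_; contradiction)
open import Relation.Nullary.Decidable using (_×-dec_)
open import Relation.Unary using (Pred; Decidable)

private
  variable
    a p : Level
    A B : Set a
    k m n q : ℕ

m*[n/o]<n⇒m≤o : ∀ m n o .{{_ : NonZero o}} → o * o ∸ o ≤ n → m * (n / o) < n → m ≤ o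
m*[n/o]<n⇒m≤o m n o@(suc j) o²∸o≤n m*[n/o]<n =
  ≮⇒≥ λ o<m → <⇒≱ (<-≤-trans (n/o<n%o o<m) (s≤s⁻¹ (m%n<n n o))) j≤n/o
  where
  open ≤-Reasoning
  n/o n%o : ℕ
  n/o = n / o
  n%o = n % o

  j≤n/o : j ≤ n/o
  j≤n/o = s≤s⁻¹ (*-cancelʳ-< o j (suc n/o) (begin-strict
    j * o          ≡⟨ m+n∸m≡n o (j * o) ⟨
    o * o ∸ o      ≤⟨ o²∸o≤n ⟩
    n              ≡⟨ m≡m%n+[m/n]*n n o ⟩
    n%o + n/o * o  <⟨ +-monoˡ-< (n/o * o) (m%n<n n o) ⟩
    o + n/o * o    ∎))

  n/o<n%o : o < m → n/o < n%o
  n/o<n%o o<m = +-cancelʳ-< (n/o * o) n/o n%o (begin-strict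
    n/o + n/o * o  ≡⟨ cong (n/o +_) (*-comm n/o o) ⟩
    suc o * n/o    ≤⟨ *-monoˡ-≤ n/o o<m ⟩
    m * n/o        <⟨ m*[n/o]<n ⟩
    n              ≡⟨ m≡m%n+[m/n]*n n o ⟩
    n%o + n/o * o  ∎)

𝟙 : Dec A → ℕ
𝟙 A? = if does A? then 1 else 0

𝟙-yes : (A? : Dec A) → A → 𝟙 A? ≡ 1
𝟙-yes (yes _) _ = refl
𝟙-yes (no ¬a) a = contradiction a ¬a

𝟙-×-dec : (A? : Dec A) (B? : Dec B) → 𝟙 (A? ×-dec B?) ≡ 𝟙 A? * 𝟙 B?
𝟙-×-dec A? B? with does A? | does B?
... | false | _     = refl
... | true  | false = refl
... | true  | true  = refl

count : {P : Pred (Fin m) p} → Decidable P → ℕ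
count {m} P? = ∑[ i < m ] 𝟙 (P? i)

length-filter-tabulate : {P : Pred A p} (P? : Decidable P) (f : Fin m → A) →
                         length (filter P? (tabulate f)) ≡ count (P? ∘ f)
length-filter-tabulate {m = zero}  P? f = refl
length-filter-tabulate {m = suc m} P? f with does (P? (f zero))
... | false = length-filter-tabulate P? (f ∘ suc)
... | true  = cong suc (length-filter-tabulate P? (f ∘ suc))

length-filter-allFin : {P : Pred (Fin m) p} (P? : Decidable P) → length (filter P? (allFin m)) ≡ count P?
length-filter-allFin P? = length-filter-tabulate P? (λ i → i)

count-∈ : (S : Subset n) → count (_∈? S) ≡ ∣ S ∣
count-∈ {zero}  []            = refl
count-∈ {suc n} (inside  ∷ S) = cong suc (count-∈ S)
count-∈ {suc n} (outside ∷ S) = count-∈ S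

count-≟ : (x : Fin n) → count (x ≟_) ≡ 1
count-≟ {suc n} zero    = cong suc (sum-replicate-zero n)
count-≟ {suc n} (suc x) = count-≟ x

sum-mono-≤ : {f g : Fin n → ℕ} → (∀ i → f i ≤ g i) → sum f ≤ sum g
sum-mono-≤ {zero}  f≤g = z≤n
sum-mono-≤ {suc n} f≤g = +-mono-≤ (f≤g zero) (sum-mono-≤ (f≤g ∘ suc))

term≤sum : (f : Fin n → ℕ) (i : Fin n) → f i ≤ sum f
term≤sum f zero    = m≤m+n (f zero) _
term≤sum f (suc i) = ≤-trans (term≤sum (f ∘ suc) i) (m≤n+m _ (f zero))

sum<n⇒∃≡0 : (f : Fin n → ℕ) → sum f < n → ∃ λ i → f i ≡ 0
sum<n⇒∃≡0 {suc n} f ∑f<n with f zero in f0≡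
... | zero  = zero , f0≡
... | suc x with i , fi≡0 ← sum<n⇒∃≡0 (f ∘ suc) (≤-trans (s≤s (m≤n+m _ x)) (s≤s⁻¹ ∑f<n)) = suc i , fi≡0

markov : ∀ x (f : Fin n → ℕ) → count (λ i → x ≤? f i) * x ≤ sum f
markov {zero}  x f = z≤n
markov {suc n} x f = begin
  (𝟙 (x ≤? f zero) + count (λ i → x ≤? f (suc i))) * x   ≡⟨ *-distribʳ-+ x (𝟙 (x ≤? f zero)) _ ⟩
  𝟙 (x ≤? f zero) * x + count (λ i → x ≤? f (suc i)) * x  ≤⟨ +-mono-≤ (𝟙-≤?-* (x ≤? f zero)) (markov x (f ∘ suc)) ⟩
  f zero + sum (f ∘ suc)                                  ∎
  where
  open ≤-Reasoning
  𝟙-≤?-* : ∀ {y} (x≤?y : Dec (x ≤ y)) → 𝟙 x≤?y * x ≤ y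
  𝟙-≤?-* (yes x≤y) = ≤-trans (≤-reflexive (+-identityʳ x)) x≤y
  𝟙-≤?-* (no _)    = z≤n

𝟙-*-count : {P : Pred (Fin m) p} (P? : Decidable P) (B? : Dec B) → 𝟙 B? * count P? ≡ count (λ i → B? ×-dec P? i)
𝟙-*-count {m} P? B? = begin
  𝟙 B? * count P?               ≡⟨ *-distribˡ-sum (𝟙 B?) (𝟙 ∘ P?) ⟩
  ∑[ i < m ] (𝟙 B? * 𝟙 (P? i))  ≡⟨ sum-cong-≗ (λ i → 𝟙-×-dec B? (P? i)) ⟨
  count (λ i → B? ×-dec P? i)   ∎
  where open ≡-Reasoning

∑-count-fibres : {P : Pred (Fin m) p} (P? : Decidable P) (c : Fin m → Fin q) →
                 ∑[ a < q ] count (λ j → P? j ×-dec (c j ≟ a)) ≡ count P?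
∑-count-fibres {m} {q = q} P? c = begin
  ∑[ a < q ] ∑[ j < m ] 𝟙 (P? j ×-dec (c j ≟ a))  ≡⟨ ∑-comm (λ a j → 𝟙 (P? j ×-dec (c j ≟ a))) ⟩
  ∑[ j < m ] ∑[ a < q ] 𝟙 (P? j ×-dec (c j ≟ a))  ≡⟨ sum-cong-≗ fibre ⟩
  count P?                                        ∎
  where
  open ≡-Reasoning
  fibre : ∀ j → count (λ a → P? j ×-dec (c j ≟ a)) ≡ 𝟙 (P? j)
  fibre j = begin
    count (λ a → P? j ×-dec (c j ≟ a)) ≡⟨ 𝟙-*-count (c j ≟_) (P? j) ⟨
    𝟙 (P? j) * count (c j ≟_)          ≡⟨ cong (𝟙 (P? j) *_) (count-≟ (c j)) ⟩
    𝟙 (P? j) * 1                       ≡⟨ *-identityʳ _ ⟩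
    𝟙 (P? j)                           ∎

avoiding-colour : (S : Subset n) {Bad : Fin n → Pred (Fin q) p} (Bad? : ∀ v → Decidable (Bad v)) →
                  (∀ v → v ∈ S → count (Bad? v) ≤ k) → k * ∣ S ∣ < q →
                  ∃ λ a → ∀ v → v ∈ S → ¬ Bad v a
avoiding-colour {n} {q} {k = k} S {Bad} Bad? few k∣S∣<q = unloaded (sum<n⇒∃≡0 load (≤-<-trans total≤ k∣S∣<q))
  where
  open ≤-Reasoning
  load : Fin q → ℕ
  load a = count (λ v → v ∈? S ×-dec Bad? v a)

  bound : ∀ v → 𝟙 (v ∈? S) * count (Bad? v) ≤ k * 𝟙 (v ∈? S)
  bound v with v ∈? S
  ... | yes v∈S = ≤-trans (≤-reflexive (+-identityʳ _)) (≤-trans (few v v∈S) (≤-reflexive (sym (*-identityʳ k))))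
  ... | no  _   = z≤n

  total≤ : ∑[ a < q ] load a ≤ k * ∣ S ∣
  total≤ = begin
    ∑[ a < q ] load a                               ≡⟨ ∑-comm (λ a v → 𝟙 (v ∈? S ×-dec Bad? v a)) ⟩
    ∑[ v < n ] count (λ a → v ∈? S ×-dec Bad? v a)  ≡⟨ sum-cong-≗ (λ v → 𝟙-*-count (Bad? v) (v ∈? S)) ⟨
    ∑[ v < n ] (𝟙 (v ∈? S) * count (Bad? v))        ≤⟨ sum-mono-≤ bound ⟩
    ∑[ v < n ] (k * 𝟙 (v ∈? S))                     ≡⟨ *-distribˡ-sum k (λ v → 𝟙 (v ∈? S)) ⟨
    k * count (_∈? S)                               ≡⟨ cong (k *_) (count-∈ S) ⟩
    k * ∣ S ∣                                        ∎

  unloaded : (∃ λ a → load a ≡ 0) → ∃ λ a → ∀ v → v ∈ S → ¬ Bad v a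
  unloaded (a , load≡0) = a , λ v v∈S bad →
    1+n≰n (subst₂ _≤_ (𝟙-yes (v ∈? S ×-dec Bad? v a) (v∈S , bad)) load≡0 (term≤sum _ v))

degreeIn : (Fin m → Subset n) → Fin n → ℕ
degreeIn e v = count (λ j → v ∈? e j)

colourDegreeIn : (Fin m → Subset n) → (Fin m → Fin q) → Fin n → Fin q → ℕ
colourDegreeIn e c v a = count (λ j → v ∈? e j ×-dec (c j ≟ a))

degreeIn-tail< : (e : Fin (suc m) → Subset n) {v : Fin n} → v ∈ e zero → degreeIn (tail e) v < degreeIn e v
degreeIn-tail< e {v} v∈e₀ with v ∈? e zero
... | yes _    = ≤-refl
... | no  v∉e₀ = contradiction v∈e₀ v∉e₀

RespectsCaps : (Fin m → Subset n) → (Fin n → ℕ) → (Fin m → Fin q) → Set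
RespectsCaps e cap c = ∀ v a → colourDegreeIn e c v a ≤ cap v

FewSaturated : ℕ → (Fin m → Subset n) → (Fin n → ℕ) → Set
FewSaturated k e cap = ∀ v B → B * cap v < degreeIn e v → B ≤ k

FewSaturated-tail : (e : Fin (suc m) → Subset n) (cap : Fin n → ℕ) →
                    FewSaturated k e cap → FewSaturated k (tail e) cap
FewSaturated-tail e cap few v B B*cap<d = few v B (<-≤-trans B*cap<d (m≤n+m _ (𝟙 (v ∈? e zero))))

colour-first-edge : (e : Fin (suc m) → Subset n) (cap : Fin n → ℕ) →
                    k * ∣ e zero ∣ < q → FewSaturated k e cap →
                    (c : Fin m → Fin q) → RespectsCaps (tail e) cap c →
                    Σ (Fin (suc m) → Fin q) (RespectsCaps e cap)
colour-first-edge {m} {k = k} {q = q} e cap k∣e₀∣<q few c c-respects =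
  extend (avoiding-colour (e zero) saturated? saturated-few k∣e₀∣<q)
  where
  saturated? : ∀ v a → Dec (cap v ≤ colourDegreeIn (tail e) c v a)
  saturated? v a = cap v ≤? colourDegreeIn (tail e) c v a

  saturated-few : ∀ v → v ∈ e zero → count (saturated? v) ≤ k
  saturated-few v v∈e₀ = few v _ (begin-strict
    count (saturated? v) * cap v              ≤⟨ markov (cap v) (colourDegreeIn (tail e) c v) ⟩
    ∑[ a < q ] colourDegreeIn (tail e) c v a  ≡⟨ ∑-count-fibres (λ j → v ∈? tail e j) c ⟩
    degreeIn (tail e) v                       <⟨ degreeIn-tail< e v∈e₀ ⟩
    degreeIn e v                              ∎)
    where open ≤-Reasoning

  extend : (∃ λ a → ∀ v → v ∈ e zero → ¬ cap v ≤ colourDegreeIn (tail e) c v a) →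
           Σ (Fin (suc m) → Fin q) (RespectsCaps e cap)
  extend (a , a-free) = a ◂ c , fits
    where
    fits : RespectsCaps e cap (a ◂ c)
    fits v b with v ∈? e zero | a ≟ b
    ... | yes v∈e₀ | yes refl = ≰⇒> (a-free v v∈e₀)
    ... | yes _    | no  _    = c-respects v b
    ... | no  _    | _        = c-respects v b

greedy-colouring : (e : Fin m → Subset n) (cap : Fin n → ℕ) →
                   (∀ j → k * ∣ e j ∣ < q) → FewSaturated k e cap →
                   Σ (Fin m → Fin q) (RespectsCaps e cap)
greedy-colouring {zero}  e cap k∣e∣<q few = (λ ()) , λ _ _ → z≤n
greedy-colouring {suc m} e cap k∣e∣<q few
  with c , c-respects ← greedy-colouring (tail e) cap (k∣e∣<q ∘ suc) (FewSaturated-tail e cap few) =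
  colour-first-edge e cap (k∣e∣<q zero) few c c-respects

degree≡degreeIn : (H : Hypergraph n m) (v : Fin n) → degree H v ≡ degreeIn (edge H) v
degree≡degreeIn H v = length-filter-allFin (λ j → v ∈? edge H j)

colourDegree≡colourDegreeIn : (H : Hypergraph n m) (c : Fin m → Fin q) (v : Fin n) (a : Fin q) →
                              colourDegree H c v a ≡ colourDegreeIn (edge H) c v a
colourDegree≡colourDegreeIn H c v a = length-filter-allFin (λ j → v ∈? edge H j ×-dec (c j ≟ a))

theorem3 : (k : ℕ) → .{{_ : NonZero k}} → 2 ≤ k →
    (n m r : ℕ) (H : Hypergraph n m) →
    Linear H → HasRank H r → MinDegreeAtLeast H (k * k ∸ k) →
    Σ (Fin m → Fin (k * r + 1)) (λ c → IsMajorityColouring H k (k * r + 1) c)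
theorem3 k _ n m r H _ (∣e∣≤r , _) k²∸k≤d =
  majority (greedy-colouring (edge H) cap k∣e∣<kr+1 few-saturated)
  where
  cap : Fin n → ℕ
  cap v = degree H v / k

  k∣e∣<kr+1 : ∀ j → k * ∣ edge H j ∣ < k * r + 1
  k∣e∣<kr+1 j = <-≤-trans (s≤s (*-monoʳ-≤ k (∣e∣≤r j))) (≤-reflexive (+-comm 1 (k * r)))

  few-saturated : FewSaturated k (edge H) cap
  few-saturated v B B*cap<d = m*[n/o]<n⇒m≤o B (degree H v) k (k²∸k≤d v)
    (subst (B * cap v <_) (sym (degree≡degreeIn H v)) B*cap<d)

  majority : Σ (Fin m → Fin (k * r + 1)) (RespectsCaps (edge H) cap) →
             Σ (Fin m → Fin (k * r + 1)) (IsMajorityColouring H k (k * r + 1))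
  majority (c , c-respects) = c , λ v a → subst (_≤ cap v) (sym (colourDegree≡colourDegreeIn H c v a)) (c-respects v a)
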